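{- Fix a positive integer $k$. Let $A,B\subset\mathbb{N}_0^2$ be finite non-empty sets and choose an integer $m>k\cdot M_A$, where $M_A=\max\{t: (t,y)\in A \text{ or } (x,t)\in A\}$ is the largest coordinate of any point of $A$. Let $C=A+m\cdot B=\{u+mv: u\in A, v\in B\}$. Then $|sC-dC|=|sA-dA|\cdot|sB-dB|$ for all non-negative integers $s,d$ with $s+d\leq k$.
   Context: $\mathbb{N}_0=\{0,1,2,\dots\}$. For a finite set $X\subset\mathbb{Z}^2$ and non-negative integers $s,d$, $sX-dX=\{u_1+\cdots+u_s-v_1-\cdots-v_d:u_i,v_j\in X\}$ (empty sums equal $0$); $m\cdot B$ denotes the usual scalar multiple $\{mv:v\in B\}$. -}

module Defs where

open import Data.Nat as ℕ using (ℕ; zero; suc; _⊔_)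
open import Data.Integer as ℤ using (ℤ; +_)
import Data.Integer.Properties as ℤP
open import Data.Product using (_×_; _,_)
open import Data.Product.Properties using (≡-dec)
open import Data.List using (List; []; _∷_; map; foldr; length; deduplicate; concatMap)

Pt : Set
Pt = ℤ × ℤ

PtN : Set
PtN = ℕ × ℕ

_+ᵖ_ : Pt → Pt → Pt
(a , b) +ᵖ (c , d) = (a ℤ.+ c , b ℤ.+ d)

_-ᵖ_ : Pt → Pt → Pt
(a , b) -ᵖ (c , d) = (a ℤ.- c , b ℤ.- d)

_≟ᵖ_ : (p q : Pt) → _
_≟ᵖ_ = ≡-dec ℤ._≟_ ℤ._≟_

toℤ² : PtN → Pt
toℤ² (x , y) = (+ x , + y)

-- Finite sets are represented by lists (possibly with repetitions);
-- cardinality = number of distinct elements.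
card : List Pt → ℕ
card X = length (deduplicate _≟ᵖ_ X)

sumset : ℕ → List Pt → List Pt
sumset zero    X = (+ 0 , + 0) ∷ []
sumset (suc s) X = concatMap (λ u → map (λ v → u +ᵖ v) (sumset s X)) X

sdset : ℕ → ℕ → List Pt → List Pt
sdset s d X = concatMap (λ u → map (λ v → u -ᵖ v) (sumset d X)) (sumset s X)

-- M_A : largest coordinate of any point of A (0 for empty A).
maxCoord : List PtN → ℕ
maxCoord = foldr (λ { (x , y) acc → x ⊔ y ⊔ acc }) 0

dilSum : List PtN → ℕ → List PtN → List PtN
dilSum A m B = concatMap (λ { (x , y) → map (λ { (a , b) → (x ℕ.+ m ℕ.* a , y ℕ.+ m ℕ.* b) }) B }) A

-- The map (u , v) ↦ u + m·v is additive, so sC − dC is its image of (sA − dA) × (sB − dB).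
-- Two points of sA − dA differ in each coordinate by at most (s + d)·M_A < m, and a difference
-- that is a multiple of m yet smaller than m vanishes; so the map is injective on that product
-- and the cardinalities multiply.
module Submission where

open import Defs
open import Algebra.Definitions using (Interchangable)
open import Level using (Level)
open import Data.Nat using (ℕ; zero; suc; _+_; _*_; _⊔_; _<_; _≤_; z≤n)
import Data.Nat.Properties as ℕ
open import Data.Integer as ℤ using (ℤ; +_; ∣_∣; _⊖_)
import Data.Integer.Properties as ℤ
open import Data.Integer.Tactic.RingSolver using (solve-∀)
open import Data.Empty using (⊥)
open import Data.Product as Product using (∃; ∃₂; _×_; _,_; proj₁; proj₂)
open import Data.List
  using (List; []; _∷_; _++_; map; concatMap; length; deduplicate; cartesianProductWith)
open import Data.List.Properties using (length-++; length-map; map-++; map-∘; map-cong)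
open import Data.List.Membership.Propositional using (_∈_)
open import Data.List.Membership.Propositional.Properties
  using ( ∈-map⁻; ∈-cartesianProductWith⁺; ∈-cartesianProductWith⁻
        ; ∈-deduplicate⁻; deduplicate-∈⇔)
open import Data.List.Membership.Propositional.Properties.WithK using (unique∧set⇒bag)
open import Data.List.Relation.Unary.Any using (here; there)
open import Data.List.Relation.Unary.All as All using ()
import Data.List.Relation.Unary.All.Properties as All
open import Data.List.Relation.Unary.AllPairs using ([]; _∷_)
open import Data.List.Relation.Unary.Unique.Propositional using (Unique)
import Data.List.Relation.Unary.Unique.Propositional.Properties as Unique
open import Data.List.Relation.Unary.Unique.DecPropositional.Properties using (deduplicate-!)
open import Data.List.Relation.Binary.BagAndSetEquality
  using (_∼[_]_; set; [_]-Equality; ∼bag⇒↭; ∷-cong)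
open import Data.List.Relation.Binary.Permutation.Propositional.Properties using (↭-length)
open import Function.Bundles using (mk⇔; Equivalence)
open import Relation.Binary.Bundles using (Setoid)
open import Relation.Binary.Definitions using (DecidableEquality)
open import Relation.Binary.PropositionalEquality
  using (_≡_; _≢_; refl; sym; trans; cong; cong₂; subst; module ≡-Reasoning)
open import Relation.Nullary using (contradiction)
open import Function using (_∘_)

private
  variable
    a : Level
    A B C : Set a

module _ {A : Set a} where
  open Setoid ([ set ]-Equality A) public
    using () renaming (refl to ∼-refl; sym to ∼-sym; trans to ∼-trans)

length-unique-cong : {xs ys : List A} → Unique xs → Unique ys → xs ∼[ set ] ys →
                     length xs ≡ length ys
length-unique-cong xs! ys! xs∼ys = ↭-length (∼bag⇒↭ (unique∧set⇒bag xs! ys! xs∼ys))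

module _ {A : Set a} (_≟_ : DecidableEquality A) where

  deduplicate-∼ : (xs : List A) → deduplicate _≟_ xs ∼[ set ] xs
  deduplicate-∼ xs = ∼-sym {x = xs} (deduplicate-∈⇔ _≟_)

  length-deduplicate-cong : {xs ys : List A} → xs ∼[ set ] ys →
                            length (deduplicate _≟_ xs) ≡ length (deduplicate _≟_ ys)
  length-deduplicate-cong {xs} {ys} xs∼ys =
    length-unique-cong (deduplicate-! _≟_ xs) (deduplicate-! _≟_ ys)
      (∼-trans (deduplicate-∼ xs) (∼-trans xs∼ys (∼-sym (deduplicate-∼ ys))))

  length-deduplicate-unique : {xs : List A} → Unique xs →
                              length (deduplicate _≟_ xs) ≡ length xs
  length-deduplicate-unique {xs} xs! =
    length-unique-cong (deduplicate-! _≟_ xs) xs! (deduplicate-∼ xs)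

concatMap-map≡cartesianProductWith : (f : A → B → C) (xs : List A) (ys : List B) →
  concatMap (λ x → map (f x) ys) xs ≡ cartesianProductWith f xs ys
concatMap-map≡cartesianProductWith f []       ys = refl
concatMap-map≡cartesianProductWith f (x ∷ xs) ys =
  cong (map (f x) ys ++_) (concatMap-map≡cartesianProductWith f xs ys)

length-cartesianProductWith : (f : A → B → C) (xs : List A) (ys : List B) →
  length (cartesianProductWith f xs ys) ≡ length xs * length ys
length-cartesianProductWith f []       ys = refl
length-cartesianProductWith f (x ∷ xs) ys = trans (length-++ (map (f x) ys))
  (cong₂ _+_ (length-map (f x) ys) (length-cartesianProductWith f xs ys))

cartesianProductWith-⊆ : (f : A → B → C) {xs xs′ : List A} {ys ys′ : List B} →
  (∀ {x} → x ∈ xs → x ∈ xs′) → (∀ {y} → y ∈ ys → y ∈ ys′) →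
  ∀ {v} → v ∈ cartesianProductWith f xs ys → v ∈ cartesianProductWith f xs′ ys′
cartesianProductWith-⊆ f {xs} {ys = ys} xs⊆xs′ ys⊆ys′ v∈
  with ∈-cartesianProductWith⁻ f xs ys v∈
... | x , y , x∈ , y∈ , refl = ∈-cartesianProductWith⁺ f (xs⊆xs′ x∈) (ys⊆ys′ y∈)

cartesianProductWith-cong : (f : A → B → C) {xs xs′ : List A} {ys ys′ : List B} →
  xs ∼[ set ] xs′ → ys ∼[ set ] ys′ →
  cartesianProductWith f xs ys ∼[ set ] cartesianProductWith f xs′ ys′
cartesianProductWith-cong f xs∼xs′ ys∼ys′ = mk⇔
  (cartesianProductWith-⊆ f (Equivalence.to xs∼xs′) (Equivalence.to ys∼ys′))
  (cartesianProductWith-⊆ f (Equivalence.from xs∼xs′) (Equivalence.from ys∼ys′))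

cartesianProductWith-interchange : (f h : A → A → A) → Interchangable _≡_ h f →
  ∀ P Q R S →
  cartesianProductWith h (cartesianProductWith f P Q) (cartesianProductWith f R S)
    ∼[ set ] cartesianProductWith f (cartesianProductWith h P R) (cartesianProductWith h Q S)
cartesianProductWith-interchange f h f-h P Q R S = mk⇔ to from
  where
  hf fh : List _
  hf = cartesianProductWith h (cartesianProductWith f P Q) (cartesianProductWith f R S)
  fh = cartesianProductWith f (cartesianProductWith h P R) (cartesianProductWith h Q S)

  to : ∀ {v} → v ∈ hf → v ∈ fh
  to v∈ with ∈-cartesianProductWith⁻ h _ _ v∈
  ... | _ , _ , u∈ , w∈ , refl
    with ∈-cartesianProductWith⁻ f P Q u∈ | ∈-cartesianProductWith⁻ f R S w∈
  ... | p , q , p∈ , q∈ , refl | r , s , r∈ , s∈ , refl = subst (_∈ fh) (sym (f-h p q r s))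
    (∈-cartesianProductWith⁺ f (∈-cartesianProductWith⁺ h p∈ r∈)
                               (∈-cartesianProductWith⁺ h q∈ s∈))

  from : ∀ {v} → v ∈ fh → v ∈ hf
  from v∈ with ∈-cartesianProductWith⁻ f _ _ v∈
  ... | _ , _ , u∈ , w∈ , refl
    with ∈-cartesianProductWith⁻ h P R u∈ | ∈-cartesianProductWith⁻ h Q S w∈
  ... | p , r , p∈ , r∈ , refl | q , s , q∈ , s∈ , refl = subst (_∈ hf) (f-h p q r s)
    (∈-cartesianProductWith⁺ h (∈-cartesianProductWith⁺ f p∈ q∈)
                               (∈-cartesianProductWith⁺ f r∈ s∈))

InjectiveOn₂ : (A → B → C) → List A → List B → Set _
InjectiveOn₂ f xs ys = ∀ {w x y z} → w ∈ xs → x ∈ xs → y ∈ ys → z ∈ ys →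
                       f w y ≡ f x z → w ≡ x × y ≡ z

unique-map⁺ : (g : A → B) {ys : List A} →
  (∀ {y y′} → y ∈ ys → y′ ∈ ys → g y ≡ g y′ → y ≡ y′) →
  Unique ys → Unique (map g ys)
unique-map⁺ g g-inj []           = []
unique-map⁺ g g-inj (y∉ys ∷ ys!) =
  All.map⁺ (All.tabulate λ y′∈ gy≡gy′ →
    All.lookup y∉ys y′∈ (g-inj (here refl) (there y′∈) gy≡gy′))
  ∷ unique-map⁺ g (λ y∈ y′∈ → g-inj (there y∈) (there y′∈)) ys!

unique-cartesianProductWith⁺ : (f : A → B → C) {xs : List A} {ys : List B} →
  InjectiveOn₂ f xs ys → Unique xs → Unique ys → Unique (cartesianProductWith f xs ys)
unique-cartesianProductWith⁺ f f-inj []           ys! = []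
unique-cartesianProductWith⁺ f {x ∷ xs} {ys} f-inj (x∉xs ∷ xs!) ys! = Unique.++⁺
  (unique-map⁺ (f x) (λ y∈ y′∈ → proj₂ ∘ f-inj (here refl) (here refl) y∈ y′∈) ys!)
  (unique-cartesianProductWith⁺ f (λ w∈ x∈ → f-inj (there w∈) (there x∈)) xs! ys!)
  disjoint
  where
  disjoint : ∀ {v} → v ∈ map (f x) ys × v ∈ cartesianProductWith f xs ys → ⊥
  disjoint (v∈ , v∈′) with ∈-map⁻ (f x) v∈ | ∈-cartesianProductWith⁻ f xs ys v∈′
  ... | y , y∈ , refl | x′ , y′ , x′∈ , y′∈ , e =
    All.lookup x∉xs x′∈ (proj₁ (f-inj (here refl) (there x′∈) y∈ y′∈ e))

card-cartesianProductWith : (f : Pt → Pt → Pt) {X Y : List Pt} → InjectiveOn₂ f X Y →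
                            card (cartesianProductWith f X Y) ≡ card X * card Y
card-cartesianProductWith f {X} {Y} f-inj = begin
  card (cartesianProductWith f X Y)
    ≡⟨ length-deduplicate-cong _≟ᵖ_ (cartesianProductWith-cong f (∼-sym (deduplicate-∼ _≟ᵖ_ X))
                                                                (∼-sym (deduplicate-∼ _≟ᵖ_ Y))) ⟩
  card (cartesianProductWith f X′ Y′)
    ≡⟨ length-deduplicate-unique _≟ᵖ_
         (unique-cartesianProductWith⁺ f f-inj′ (deduplicate-! _≟ᵖ_ X) (deduplicate-! _≟ᵖ_ Y)) ⟩
  length (cartesianProductWith f X′ Y′)
    ≡⟨ length-cartesianProductWith f X′ Y′ ⟩
  card X * card Y
    ∎
  where
  open ≡-Reasoning
  X′ Y′ : List Pt
  X′ = deduplicate _≟ᵖ_ X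
  Y′ = deduplicate _≟ᵖ_ Y
  f-inj′ : InjectiveOn₂ f X′ Y′
  f-inj′ w∈ x∈ y∈ z∈ = f-inj (∈-deduplicate⁻ _≟ᵖ_ X w∈) (∈-deduplicate⁻ _≟ᵖ_ X x∈)
                              (∈-deduplicate⁻ _≟ᵖ_ Y y∈) (∈-deduplicate⁻ _≟ᵖ_ Y z∈)

0ᵖ : Pt
0ᵖ = (+ 0 , + 0)

sumset-suc : ∀ n X → sumset (suc n) X ≡ cartesianProductWith _+ᵖ_ X (sumset n X)
sumset-suc n X = concatMap-map≡cartesianProductWith _+ᵖ_ X (sumset n X)

sdset≡cartesianProductWith : ∀ s d X →
  sdset s d X ≡ cartesianProductWith _-ᵖ_ (sumset s X) (sumset d X)
sdset≡cartesianProductWith s d X =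
  concatMap-map≡cartesianProductWith _-ᵖ_ (sumset s X) (sumset d X)

module _ (f : Pt → Pt → Pt) (f-zero : f 0ᵖ 0ᵖ ≡ 0ᵖ) (f-add : Interchangable _≡_ _+ᵖ_ f)
  where
  open import Relation.Binary.Reasoning.Setoid ([ set ]-Equality Pt)

  private
    _⊗_ : List Pt → List Pt → List Pt
    _⊗_ = cartesianProductWith f

  sumset-cartesianProductWith : ∀ n P Q → sumset n (P ⊗ Q) ∼[ set ] sumset n P ⊗ sumset n Q
  sumset-cartesianProductWith zero    P Q = ∷-cong (sym f-zero) (∼-refl {x = []})
  sumset-cartesianProductWith (suc n) P Q = begin
    sumset (suc n) (P ⊗ Q)
      ≡⟨ sumset-suc n (P ⊗ Q) ⟩
    cartesianProductWith _+ᵖ_ (P ⊗ Q) (sumset n (P ⊗ Q))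
      ≈⟨ cartesianProductWith-cong _+ᵖ_ (∼-refl {x = P ⊗ Q})
                                        (sumset-cartesianProductWith n P Q) ⟩
    cartesianProductWith _+ᵖ_ (P ⊗ Q) (sumset n P ⊗ sumset n Q)
      ≈⟨ cartesianProductWith-interchange f _+ᵖ_ f-add P Q (sumset n P) (sumset n Q) ⟩
    cartesianProductWith _+ᵖ_ P (sumset n P) ⊗ cartesianProductWith _+ᵖ_ Q (sumset n Q)
      ≡⟨ cong₂ _⊗_ (sumset-suc n P) (sumset-suc n Q) ⟨
    sumset (suc n) P ⊗ sumset (suc n) Q
      ∎

  sdset-cartesianProductWith : Interchangable _≡_ _-ᵖ_ f → ∀ s d P Q →
                               sdset s d (P ⊗ Q) ∼[ set ] sdset s d P ⊗ sdset s d Q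
  sdset-cartesianProductWith f-sub s d P Q = begin
    sdset s d (P ⊗ Q)
      ≡⟨ sdset≡cartesianProductWith s d (P ⊗ Q) ⟩
    cartesianProductWith _-ᵖ_ (sumset s (P ⊗ Q)) (sumset d (P ⊗ Q))
      ≈⟨ cartesianProductWith-cong _-ᵖ_ (sumset-cartesianProductWith s P Q)
                                        (sumset-cartesianProductWith d P Q) ⟩
    cartesianProductWith _-ᵖ_ (sumset s P ⊗ sumset s Q) (sumset d P ⊗ sumset d Q)
      ≈⟨ cartesianProductWith-interchange f _-ᵖ_ f-sub
           (sumset s P) (sumset s Q) (sumset d P) (sumset d Q) ⟩
    cartesianProductWith _-ᵖ_ (sumset s P) (sumset d P)
      ⊗ cartesianProductWith _-ᵖ_ (sumset s Q) (sumset d Q)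
      ≡⟨ cong₂ _⊗_ (sdset≡cartesianProductWith s d P)
                   (sdset≡cartesianProductWith s d Q) ⟨
    sdset s d P ⊗ sdset s d Q
      ∎

_+[_]·_ : Pt → ℕ → Pt → Pt
(x , y) +[ m ]· (a , b) = (x ℤ.+ + m ℤ.* a , y ℤ.+ + m ℤ.* b)

+[]·-zero : ∀ m → 0ᵖ +[ m ]· 0ᵖ ≡ 0ᵖ
+[]·-zero m = cong (λ t → (+ 0 ℤ.+ t , + 0 ℤ.+ t)) (ℤ.*-zeroʳ (+ m))

+[]·-interchange-add : ∀ m → Interchangable _≡_ _+ᵖ_ (_+[ m ]·_)
+[]·-interchange-add m (x , y) (a , b) (x′ , y′) (a′ , b′) =
  cong₂ _,_ (regroup (+ m) x a x′ a′) (regroup (+ m) y b y′ b′)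
  where
  regroup : ∀ M x a x′ a′ →
    (x ℤ.+ M ℤ.* a) ℤ.+ (x′ ℤ.+ M ℤ.* a′) ≡ (x ℤ.+ x′) ℤ.+ M ℤ.* (a ℤ.+ a′)
  regroup = solve-∀

+[]·-interchange-sub : ∀ m → Interchangable _≡_ _-ᵖ_ (_+[ m ]·_)
+[]·-interchange-sub m (x , y) (a , b) (x′ , y′) (a′ , b′) =
  cong₂ _,_ (regroup (+ m) x a x′ a′) (regroup (+ m) y b y′ b′)
  where
  regroup : ∀ M x a x′ a′ →
    (x ℤ.+ M ℤ.* a) ℤ.- (x′ ℤ.+ M ℤ.* a′) ≡ (x ℤ.- x′) ℤ.+ M ℤ.* (a ℤ.- a′)
  regroup = solve-∀

map-toℤ²-dilSum : ∀ A m B →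
  map toℤ² (dilSum A m B) ≡ cartesianProductWith (_+[ m ]·_) (map toℤ² A) (map toℤ² B)
map-toℤ²-dilSum []            m B = refl
map-toℤ²-dilSum ((x , y) ∷ A) m B = begin
  map toℤ² (map shift B ++ dilSum A m B)
    ≡⟨ map-++ toℤ² (map shift B) (dilSum A m B) ⟩
  map toℤ² (map shift B) ++ map toℤ² (dilSum A m B)
    ≡⟨ cong₂ _++_ (trans (sym (map-∘ B)) (trans (map-cong toℤ²-shift B) (map-∘ B)))
                  (map-toℤ²-dilSum A m B) ⟩
  map ((+ x , + y) +[ m ]·_) (map toℤ² B)
    ++ cartesianProductWith (_+[ m ]·_) (map toℤ² A) (map toℤ² B)
    ∎
  where
  open ≡-Reasoning
  shift : PtN → PtN
  shift (a , b) = (x + m * a , y + m * b)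
  toℤ²-shift : ∀ q → toℤ² (shift q) ≡ (+ x , + y) +[ m ]· toℤ² q
  toℤ²-shift (a , b) = cong₂ _,_ (toℤ x a) (toℤ y b)
    where
    toℤ : ∀ x a → + (x + m * a) ≡ + x ℤ.+ + m ℤ.* + a
    toℤ x a = trans (ℤ.pos-+ x (m * a)) (cong (λ t → + x ℤ.+ t) (ℤ.pos-* m a))

difference-multiple : ∀ m (c c′ r r′ : ℤ) → c ℤ.+ + m ℤ.* r ≡ c′ ℤ.+ + m ℤ.* r′ →
                      c ℤ.- c′ ≡ + m ℤ.* (r′ ℤ.- r)
difference-multiple m c c′ r r′ e = begin
  c ℤ.- c′                               ≡⟨ regroup (+ m) c c′ r r′ ⟩
  (c ℤ.+ + m ℤ.* r) ℤ.- rhs ℤ.+ mΔr      ≡⟨ cong (λ t → t ℤ.- rhs ℤ.+ mΔr) e ⟩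
  rhs ℤ.- rhs ℤ.+ mΔr                    ≡⟨ cancel rhs mΔr ⟩
  mΔr                                    ∎
  where
  open ≡-Reasoning
  rhs mΔr : ℤ
  rhs = c′ ℤ.+ + m ℤ.* r′
  mΔr = + m ℤ.* (r′ ℤ.- r)
  regroup : ∀ M c c′ r r′ →
            c ℤ.- c′ ≡ (c ℤ.+ M ℤ.* r) ℤ.- (c′ ℤ.+ M ℤ.* r′) ℤ.+ M ℤ.* (r′ ℤ.- r)
  regroup = solve-∀
  cancel : ∀ a b → a ℤ.- a ℤ.+ b ≡ b
  cancel = solve-∀

+-*-injective : ∀ m {c c′ r r′ : ℤ} → ∣ c ℤ.- c′ ∣ < m →
                c ℤ.+ + m ℤ.* r ≡ c′ ℤ.+ + m ℤ.* r′ → c ≡ c′ × r ≡ r′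
+-*-injective m {c} {c′} {r} {r′} ∣c-c′∣<m e with ∣ r′ ℤ.- r ∣ in ∣r′-r∣≡
... | zero  = ℤ.i-j≡0⇒i≡j c c′ c-c′≡0 , sym (ℤ.i-j≡0⇒i≡j r′ r r′-r≡0)
  where
  r′-r≡0 : r′ ℤ.- r ≡ + 0
  r′-r≡0 = ℤ.∣i∣≡0⇒i≡0 ∣r′-r∣≡
  c-c′≡0 : c ℤ.- c′ ≡ + 0
  c-c′≡0 = trans (difference-multiple m c c′ r r′ e)
                 (trans (cong (+ m ℤ.*_) r′-r≡0) (ℤ.*-zeroʳ (+ m)))
... | suc k = contradiction m≤∣c-c′∣ (ℕ.<⇒≱ ∣c-c′∣<m)
  where
  open ℕ.≤-Reasoning
  m≤∣c-c′∣ : m ≤ ∣ c ℤ.- c′ ∣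
  m≤∣c-c′∣ = begin
    m                          ≤⟨ ℕ.m≤m*n m (suc k) ⟩
    m * suc k                  ≡⟨ cong (m *_) ∣r′-r∣≡ ⟨
    m * ∣ r′ ℤ.- r ∣            ≡⟨ ℤ.abs-* (+ m) (r′ ℤ.- r) ⟨
    ∣ + m ℤ.* (r′ ℤ.- r) ∣      ≡⟨ cong ∣_∣ (difference-multiple m c c′ r r′ e) ⟨
    ∣ c ℤ.- c′ ∣                ∎

CoordDiffs< : ℕ → List Pt → Set
CoordDiffs< m X = ∀ {u v} → u ∈ X → v ∈ X →
                  ∣ proj₁ u ℤ.- proj₁ v ∣ < m × ∣ proj₂ u ℤ.- proj₂ v ∣ < m

+[]·-injectiveOn : ∀ m {X} Y → CoordDiffs< m X → InjectiveOn₂ (_+[ m ]·_) X Y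
+[]·-injectiveOn m Y small u∈ v∈ _ _ e with small u∈ v∈
... | ∣Δx∣<m , ∣Δy∣<m
  with +-*-injective m ∣Δx∣<m (cong proj₁ e) | +-*-injective m ∣Δy∣<m (cong proj₂ e)
... | x≡x′ , a≡a′ | y≡y′ , b≡b′ = cong₂ _,_ x≡x′ y≡y′ , cong₂ _,_ a≡a′ b≡b′

Bounded : ℕ → List Pt → Set
Bounded N X = ∀ {z} → z ∈ X → ∃ λ p → z ≡ toℤ² p × proj₁ p ≤ N × proj₂ p ≤ N

bounded-maxCoord : ∀ A → Bounded (maxCoord A) (map toℤ² A)
bounded-maxCoord A z∈ with ∈-map⁻ toℤ² z∈
... | p , p∈ , refl = p , refl , coords≤ A p∈
  where
  coords≤ : ∀ A {p} → p ∈ A → proj₁ p ≤ maxCoord A × proj₂ p ≤ maxCoord A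
  coords≤ ((x , y) ∷ A) (here refl) =
    ℕ.m≤n⇒m≤n⊔o (maxCoord A) (ℕ.m≤m⊔n x y) , ℕ.m≤n⇒m≤n⊔o (maxCoord A) (ℕ.m≤n⊔m x y)
  coords≤ ((x , y) ∷ A) (there p∈) =
    Product.map (ℕ.m≤n⇒m≤o⊔n (x ⊔ y)) (ℕ.m≤n⇒m≤o⊔n (x ⊔ y)) (coords≤ A p∈)

bounded-sumset : ∀ {N X} → Bounded N X → ∀ n → Bounded (n * N) (sumset n X)
bounded-sumset X≤N zero    (here refl) = (0 , 0) , refl , z≤n , z≤n
bounded-sumset {N} {X} X≤N (suc n) z∈
  with ∈-cartesianProductWith⁻ _+ᵖ_ X (sumset n X) (subst (_ ∈_) (sumset-suc n X) z∈)
... | u , v , u∈ , v∈ , refl with X≤N u∈ | bounded-sumset X≤N n v∈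
... | (a , b) , refl , a≤ , b≤ | (a′ , b′) , refl , a′≤ , b′≤ =
  (a + a′ , b + b′) , sym (cong₂ _,_ (ℤ.pos-+ a a′) (ℤ.pos-+ b b′)) ,
  ℕ.+-mono-≤ a≤ a′≤ , ℕ.+-mono-≤ b≤ b′≤

∣difference-of-differences∣≤ : ∀ {S D a b a′ b′} → a ≤ S → b ≤ D → a′ ≤ S → b′ ≤ D →
  ∣ (+ a ℤ.- + b) ℤ.- (+ a′ ℤ.- + b′) ∣ ≤ S + D
∣difference-of-differences∣≤ {S} {D} {a} {b} {a′} {b′} a≤ b≤ a′≤ b′≤ = begin
  ∣ (+ a ℤ.- + b) ℤ.- (+ a′ ℤ.- + b′) ∣
    ≡⟨ cong ∣_∣ (regroup (+ a) (+ b) (+ a′) (+ b′)) ⟩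
  ∣ (+ a ℤ.+ + b′) ℤ.- (+ a′ ℤ.+ + b) ∣
    ≡⟨ cong₂ (λ i j → ∣ i ℤ.- j ∣) (ℤ.pos-+ a b′) (ℤ.pos-+ a′ b) ⟨
  ∣ + (a + b′) ℤ.- + (a′ + b) ∣
    ≡⟨ cong ∣_∣ (ℤ.m-n≡m⊖n (a + b′) (a′ + b)) ⟩
  ∣ (a + b′) ⊖ (a′ + b) ∣
    ≤⟨ ℤ.∣m⊝n∣≤m⊔n (a + b′) (a′ + b) ⟩
  (a + b′) ⊔ (a′ + b)
    ≤⟨ ℕ.⊔-lub (ℕ.+-mono-≤ a≤ b′≤) (ℕ.+-mono-≤ a′≤ b≤) ⟩
  S + D
    ∎
  where
  open ℕ.≤-Reasoning
  regroup : ∀ a b a′ b′ → (a ℤ.- b) ℤ.- (a′ ℤ.- b′) ≡ (a ℤ.+ b′) ℤ.- (a′ ℤ.+ b)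
  regroup = solve-∀

∈-sdset⁻ : ∀ s d X {u} → u ∈ sdset s d X →
           ∃₂ λ w z → w ∈ sumset s X × z ∈ sumset d X × u ≡ w -ᵖ z
∈-sdset⁻ s d X u∈ = ∈-cartesianProductWith⁻ _-ᵖ_ (sumset s X) (sumset d X)
                      (subst (_ ∈_) (sdset≡cartesianProductWith s d X) u∈)

coordDiffs-sdset : ∀ {M X} m s d → Bounded M X → (s + d) * M < m → CoordDiffs< m (sdset s d X)
coordDiffs-sdset {M} {X} m s d X≤M [s+d]M<m u∈ v∈
  with ∈-sdset⁻ s d X u∈ | ∈-sdset⁻ s d X v∈
... | w , z , w∈ , z∈ , refl | w′ , z′ , w′∈ , z′∈ , refl
  with bounded-sumset X≤M s w∈  | bounded-sumset X≤M d z∈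
     | bounded-sumset X≤M s w′∈ | bounded-sumset X≤M d z′∈
... | _ , refl , a≤ , b≤ | _ , refl , c≤ , e≤ | _ , refl , a′≤ , b′≤ | _ , refl , c′≤ , e′≤ =
  below-m (∣difference-of-differences∣≤ a≤ c≤ a′≤ c′≤) ,
  below-m (∣difference-of-differences∣≤ b≤ e≤ b′≤ e′≤)
  where
  below-m : ∀ {n} → n ≤ s * M + d * M → n < m
  below-m n≤ = ℕ.≤-<-trans (ℕ.≤-trans n≤ (ℕ.≤-reflexive (sym (ℕ.*-distribʳ-+ M s d)))) [s+d]M<m

lemma3p3 : (k : ℕ) → 1 ≤ k → (A B : List PtN) → A ≢ [] → B ≢ [] →
    (m : ℕ) → k * maxCoord A < m →
    (s d : ℕ) → s + d ≤ k →
    card (sdset s d (map toℤ² (dilSum A m B)))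
      ≡ card (sdset s d (map toℤ² A)) * card (sdset s d (map toℤ² B))
lemma3p3 k _ A B _ _ m kM<m s d s+d≤k = begin
  card (sdset s d (map toℤ² (dilSum A m B)))
    ≡⟨ cong (λ C → card (sdset s d C)) (map-toℤ²-dilSum A m B) ⟩
  card (sdset s d (cartesianProductWith (_+[ m ]·_) A′ B′))
    ≡⟨ length-deduplicate-cong _≟ᵖ_ (sdset-cartesianProductWith (_+[ m ]·_) (+[]·-zero m)
         (+[]·-interchange-add m) (+[]·-interchange-sub m) s d A′ B′) ⟩
  card (cartesianProductWith (_+[ m ]·_) (sdset s d A′) (sdset s d B′))
    ≡⟨ card-cartesianProductWith (_+[ m ]·_) (+[]·-injectiveOn m (sdset s d B′)
         (coordDiffs-sdset m s d (bounded-maxCoord A) [s+d]M<m)) ⟩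
  card (sdset s d A′) * card (sdset s d B′)
    ∎
  where
  open ≡-Reasoning
  A′ B′ : List Pt
  A′ = map toℤ² A
  B′ = map toℤ² B
  [s+d]M<m : (s + d) * maxCoord A < m
  [s+d]M<m = ℕ.≤-<-trans (ℕ.*-monoˡ-≤ (maxCoord A) s+d≤k) kM<m
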